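{- Let $K$ be an algebraically closed field. Every critically fixed, simply ramified polynomial in $K[x]$ is equivalent over $K$ to a normalized critically fixed, simply ramified polynomial.
   Context: A polynomial $\varphi\in K[x]$ of degree $d>1$ is critically fixed, simply ramified (CFSR) if $\varphi$ has $d-1$ distinct critical points (roots of $\varphi'$ in $K$), each of which is a fixed point of $\varphi$. A normalized CFSR polynomial of degree $d$ is a monic polynomial $\varphi$ with $\varphi(x)-x=d^{ -1}x\varphi'(x)$. Two polynomials $\varphi,\psi\in K[x]$ are equivalent over $K$ if $\varphi=\gamma^{ -1}\circ\psi\circ\gamma$ for some $\gamma(x)=\frac{ax+b}{cx+d}$ with $a,b,c,d\in K$, $ad-bc\neq0$. -}

module Defs where

open import Level using (Level; _⊔_) renaming (suc to lsuc)
open import Algebra.Bundles using (CommutativeRing)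
open import Data.Nat using (ℕ; zero; suc; _<_; _∸_)
open import Data.Fin using (Fin)
open import Data.List using (List; []; _∷_)
open import Data.Product using (Σ; ∃; _×_; _,_)
open import Relation.Nullary using (¬_)
open import Relation.Binary.PropositionalEquality using (_≢_)

-- A field: a commutative ring with 1 ≉ 0 in which every nonzero element
-- has a multiplicative inverse (the total function _⁻¹ is arbitrary at 0).
record Field (c ℓ : Level) : Set (lsuc (c ⊔ ℓ)) where
  field
    commutativeRing : CommutativeRing c ℓ
  open CommutativeRing commutativeRing public
  field
    _⁻¹       : Carrier → Carrier
    1#≉0#     : ¬ (1# ≈ 0#)
    ⁻¹-inverse : ∀ x → ¬ (x ≈ 0#) → x * (x ⁻¹) ≈ 1#

module Poly {c ℓ : Level} (F : Field c ℓ) where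
  open Field F

  -- Polynomials in K[x] as coefficient lists, constant term first.
  Pol : Set c
  Pol = List Carrier

  coeff : Pol → ℕ → Carrier
  coeff []       _       = 0#
  coeff (a ∷ p)  zero    = a
  coeff (a ∷ p)  (suc n) = coeff p n

  _≈ₚ_ : Pol → Pol → Set ℓ
  p ≈ₚ q = ∀ n → coeff p n ≈ coeff q n

  eval : Pol → Carrier → Carrier
  eval []      x = 0#
  eval (a ∷ p) x = a + x * eval p x

  fromℕ : ℕ → Carrier
  fromℕ zero    = 0#
  fromℕ (suc n) = 1# + fromℕ n

  -- formal derivative: coefficient of x^n in p' is (n+1) * coeff p (n+1)
  derivAux : ℕ → Pol → Pol
  derivAux k []      = []
  derivAux k (a ∷ p) = (fromℕ k * a) ∷ derivAux (suc k) p

  deriv : Pol → Pol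
  deriv []      = []
  deriv (a ∷ p) = derivAux 1 p

  HasDegree : Pol → ℕ → Set ℓ
  HasDegree p d = ¬ (coeff p d ≈ 0#) × (∀ n → d < n → coeff p n ≈ 0#)

  MonicDeg : Pol → ℕ → Set ℓ
  MonicDeg p d = HasDegree p d × coeff p d ≈ 1#

  IsCFSRDeg : Pol → ℕ → Set (c ⊔ ℓ)
  IsCFSRDeg φ d =
    1 < d × HasDegree φ d ×
    Σ (Fin (d ∸ 1) → Carrier) λ crit →
      (∀ i j → i ≢ j → ¬ (crit i ≈ crit j)) ×
      (∀ i → eval (deriv φ) (crit i) ≈ 0#) ×
      (∀ i → eval φ (crit i) ≈ crit i) ×
      (∀ z → eval (deriv φ) z ≈ 0# → ∃ λ i → z ≈ crit i)

  IsCFSR : Pol → Set (c ⊔ ℓ)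
  IsCFSR φ = ∃ λ d → IsCFSRDeg φ d

  X : Pol
  X = 0# ∷ 1# ∷ []

  -- normalized CFSR of degree d: monic, CFSR, d invertible in K, and
  -- φ(x) - x = d⁻¹ x φ'(x) in K[x] (coefficientwise; x φ' = 0 ∷ φ').
  IsNormalizedCFSR : Pol → Set (c ⊔ ℓ)
  IsNormalizedCFSR φ = ∃ λ d →
    IsCFSRDeg φ d × MonicDeg φ d × ¬ (fromℕ d ≈ 0#) ×
    (∀ n → coeff φ n - coeff X n ≈ (fromℕ d) ⁻¹ * coeff (0# ∷ deriv φ) n)

  -- φ = γ⁻¹ ∘ ψ ∘ γ with γ(x) = (ax+b)/(cx+d), ad - bc ≠ 0, stated as the
  -- identity γ ∘ φ = ψ ∘ γ at every x ∈ K where both sides are defined.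
  Equivalent : Pol → Pol → Set (c ⊔ ℓ)
  Equivalent φ ψ = Σ Carrier λ a → Σ Carrier λ b → Σ Carrier λ c' → Σ Carrier λ d →
    ¬ (a * d - b * c' ≈ 0#) ×
    (∀ x → ¬ (c' * x + d ≈ 0#) → ¬ (c' * eval φ x + d ≈ 0#) →
      (a * eval φ x + b) * (c' * eval φ x + d) ⁻¹
        ≈ eval ψ ((a * x + b) * (c' * x + d) ⁻¹))

  AlgClosed : Set (c ⊔ ℓ)
  AlgClosed = ∀ p d → 1 Data.Nat.≤ d → HasDegree p d → ∃ λ z → eval p z ≈ 0#

-- Since an algebraically closed field is infinite, polynomials are determined by their values.
-- The degree d is nonzero in K: otherwise φ' would have degree < d - 1 but d - 1 distinct roots,
-- hence vanish everywhere. For a suitable e, d (φ(x) - x) - (x - e) φ'(x) has degree < d - 1 and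
-- vanishes at the d - 1 critical points, so d (φ(x) - x) = (x - e) φ'(x). Conjugating by
-- γ(x) = α (x - e), with α^(d-1) the leading coefficient of φ, makes φ monic and turns this
-- identity into ψ(x) - x = d⁻¹ x ψ'(x).
module Submission where

open import Defs
open import Level using (Level; _⊔_)
open import Algebra.Bundles using (CommutativeRing)
import Algebra.Properties.CommutativeSemigroup as CommutativeSemigroupProperties
import Algebra.Properties.CommutativeSemiring.Exp as ExpProperties
import Algebra.Properties.Ring as RingProperties
import Algebra.Properties.Semiring.Mult.TCOptimised as SemiringMult
open import Algebra.Solver.Ring.AlmostCommutativeRing using (_-Raw-AlmostCommutative⟶_; fromCommutativeRing)
open import Data.Empty using (⊥-elim)
open import Data.Fin using (Fin) renaming (zero to fzero; suc to fsuc)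
import Data.Fin.Properties as Finₚ
open import Data.Integer as ℤ using (ℤ; +_; -[1+_]; _⊖_; sign; ∣_∣; _◃_; 0ℤ; 1ℤ)
import Data.Integer.Properties as ℤₚ
import Data.List as List
open import Data.List using ([]; _∷_; length)
open import Data.Maybe using (Maybe; just; nothing)
open import Data.Nat as ℕ using (ℕ; zero; suc; z≤n; s≤s)
import Data.Nat.Properties as ℕₚ
open import Data.Product using (Σ; ∃; _×_; _,_; proj₁; proj₂)
open import Data.Sign as Sign using (Sign)
open import Data.Sum using (inj₁; inj₂)
open import Relation.Nullary using (¬_; yes; no)
open import Relation.Binary.PropositionalEquality as ≡ using (_≡_; _≢_)
import Relation.Binary.Reasoning.Setoid as SetoidReasoning

-- ⟦_⟧ᶻ is built from the type-checking-optimised multiple _×ᴿ_, so that ⟦ 0 ⟧ᶻ, ⟦ 1 ⟧ᶻ and ⟦ -1 ⟧ᶻ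
-- are definitionally 0#, 1# and - 1#: solved equations then contain the ring's own constants.
module ℤ-RingSolver {c ℓ : Level} (R : CommutativeRing c ℓ) where
  open CommutativeRing R
  open RingProperties ring using (-‿involutive; -0#≈0#; -‿+-comm; -1*x≈-x)
  open SemiringMult semiring using (1+×; ×-homo-+; ×1-homo-*) renaming (_×_ to _×ᴿ_)
  open CommutativeSemigroupProperties +-commutativeSemigroup using () renaming (interchange to +-interchange)
  open CommutativeSemigroupProperties *-commutativeSemigroup using () renaming (interchange to *-interchange)
  open SetoidReasoning setoid

  ⟦_⟧ᶻ : ℤ → Carrier
  ⟦ + n ⟧ᶻ      = n ×ᴿ 1#
  ⟦ -[1+ n ] ⟧ᶻ = - (suc n ×ᴿ 1#)

  ⊖-homo : ∀ m n → ⟦ m ⊖ n ⟧ᶻ ≈ m ×ᴿ 1# - n ×ᴿ 1#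
  ⊖-homo m       zero    = sym (trans (+-congˡ -0#≈0#) (+-identityʳ _))
  ⊖-homo zero    (suc n) = sym (+-identityˡ _)
  ⊖-homo (suc m) (suc n) = begin
    ⟦ suc m ⊖ suc n ⟧ᶻ                ≡⟨ ≡.cong ⟦_⟧ᶻ (ℤₚ.[1+m]⊖[1+n]≡m⊖n m n) ⟩
    ⟦ m ⊖ n ⟧ᶻ                        ≈⟨ ⊖-homo m n ⟩
    m ×ᴿ 1# - n ×ᴿ 1#                 ≈⟨ cancel 1# (m ×ᴿ 1#) (n ×ᴿ 1#) ⟨
    (1# + m ×ᴿ 1#) - (1# + n ×ᴿ 1#)   ≈⟨ +-cong (1+× m 1#) (-‿cong (1+× n 1#)) ⟨
    suc m ×ᴿ 1# - suc n ×ᴿ 1#         ∎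
    where
    cancel : ∀ a x y → (a + x) - (a + y) ≈ x - y
    cancel a x y = begin
      (a + x) - (a + y)       ≈⟨ +-congˡ (-‿+-comm a y) ⟨
      (a + x) + (- a + - y)   ≈⟨ +-interchange a x (- a) (- y) ⟩
      (a - a) + (x - y)       ≈⟨ +-congʳ (-‿inverseʳ a) ⟩
      0# + (x - y)            ≈⟨ +-identityˡ _ ⟩
      x - y                   ∎

  +-homo : ∀ i j → ⟦ i ℤ.+ j ⟧ᶻ ≈ ⟦ i ⟧ᶻ + ⟦ j ⟧ᶻ
  +-homo (+ m)    (+ n)    = ×-homo-+ 1# m n
  +-homo (+ m)    -[1+ n ] = ⊖-homo m (suc n)
  +-homo -[1+ m ] (+ n)    = trans (⊖-homo n (suc m)) (+-comm _ _)
  +-homo -[1+ m ] -[1+ n ] = begin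
    - (suc (suc (m ℕ.+ n)) ×ᴿ 1#)       ≡⟨ ≡.cong (λ k → - (suc k ×ᴿ 1#)) (ℕₚ.+-suc m n) ⟨
    - ((suc m ℕ.+ suc n) ×ᴿ 1#)         ≈⟨ -‿cong (×-homo-+ 1# (suc m) (suc n)) ⟩
    - (suc m ×ᴿ 1# + suc n ×ᴿ 1#)       ≈⟨ -‿+-comm _ _ ⟨
    - (suc m ×ᴿ 1#) + - (suc n ×ᴿ 1#)   ∎

  ⟦_⟧ˢ : Sign → Carrier
  ⟦ Sign.+ ⟧ˢ = 1#
  ⟦ Sign.- ⟧ˢ = - 1#

  ◃-homo : ∀ s n → ⟦ s ◃ n ⟧ᶻ ≈ ⟦ s ⟧ˢ * (n ×ᴿ 1#)
  ◃-homo s        zero    = sym (zeroʳ _)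
  ◃-homo Sign.+ (suc n) = sym (*-identityˡ _)
  ◃-homo Sign.- (suc n) = sym (-1*x≈-x _)

  sign-homo : ∀ s t → ⟦ s Sign.* t ⟧ˢ ≈ ⟦ s ⟧ˢ * ⟦ t ⟧ˢ
  sign-homo Sign.+ t      = sym (*-identityˡ _)
  sign-homo Sign.- Sign.+ = sym (*-identityʳ _)
  sign-homo Sign.- Sign.- = sym (trans (-1*x≈-x _) (-‿involutive 1#))

  *-homo : ∀ i j → ⟦ i ℤ.* j ⟧ᶻ ≈ ⟦ i ⟧ᶻ * ⟦ j ⟧ᶻ
  *-homo i j = begin
    ⟦ (sign i Sign.* sign j) ◃ (∣ i ∣ ℕ.* ∣ j ∣) ⟧ᶻ          ≈⟨ ◃-homo (sign i Sign.* sign j) (∣ i ∣ ℕ.* ∣ j ∣) ⟩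
    ⟦ sign i Sign.* sign j ⟧ˢ * ((∣ i ∣ ℕ.* ∣ j ∣) ×ᴿ 1#)    ≈⟨ *-cong (sign-homo (sign i) (sign j)) (×1-homo-* ∣ i ∣ ∣ j ∣) ⟩
    (⟦ sign i ⟧ˢ * ⟦ sign j ⟧ˢ) * (∣ i ∣ ×ᴿ 1# * ∣ j ∣ ×ᴿ 1#) ≈⟨ *-interchange _ _ _ _ ⟩
    (⟦ sign i ⟧ˢ * ∣ i ∣ ×ᴿ 1#) * (⟦ sign j ⟧ˢ * ∣ j ∣ ×ᴿ 1#) ≈⟨ *-cong (abs-sign i) (abs-sign j) ⟨
    ⟦ i ⟧ᶻ * ⟦ j ⟧ᶻ                                            ∎
    where
    abs-sign : ∀ k → ⟦ k ⟧ᶻ ≈ ⟦ sign k ⟧ˢ * (∣ k ∣ ×ᴿ 1#)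
    abs-sign k = trans (reflexive (≡.cong ⟦_⟧ᶻ (≡.sym (ℤₚ.◃-inverse k)))) (◃-homo (sign k) ∣ k ∣)

  -‿homo : ∀ i → ⟦ ℤ.- i ⟧ᶻ ≈ - ⟦ i ⟧ᶻ
  -‿homo (+ zero)  = sym -0#≈0#
  -‿homo (+ suc n) = refl
  -‿homo -[1+ n ]  = sym (-‿involutive _)

  ℤ⟶R : ℤ.+-*-rawRing -Raw-AlmostCommutative⟶ fromCommutativeRing R
  ℤ⟶R = record
    { ⟦_⟧ = ⟦_⟧ᶻ ; +-homo = +-homo ; *-homo = *-homo ; -‿homo = -‿homo
    ; 0-homo = refl ; 1-homo = refl }

  weakly-decide : ∀ i j → Maybe (⟦ i ⟧ᶻ ≈ ⟦ j ⟧ᶻ)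
  weakly-decide i j with i ℤ.≟ j
  ... | yes ≡.refl = just refl
  ... | no _       = nothing

  open import Algebra.Solver.Ring ℤ.+-*-rawRing (fromCommutativeRing R) ℤ⟶R weakly-decide public

module PolynomialsOver {c ℓ : Level} (F : Field c ℓ) where
  open Field F hiding (zero)
  open Poly F
  open RingProperties ring using (x∙y⁻¹≈ε⇒x≈y; x≈y⇒x∙y⁻¹≈ε; -1*x≈-x; -0#≈0#)
  open ℤ-RingSolver commutativeRing using (solve; _:=_; _:+_; _:*_; _:-_; :-_; con)
  open SetoidReasoning setoid
  open ExpProperties commutativeSemiring using (_^_; ^-congˡ; ^-distrib-*)

  ⁻¹-cancelˡ : ∀ {x} y → ¬ x ≈ 0# → x ⁻¹ * (x * y) ≈ y
  ⁻¹-cancelˡ {x} y x≉0 = begin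
    x ⁻¹ * (x * y)   ≈⟨ solve 3 (λ x x⁻¹ y → x⁻¹ :* (x :* y) := (x :* x⁻¹) :* y) refl x (x ⁻¹) y ⟩
    (x * x ⁻¹) * y   ≈⟨ *-congʳ (⁻¹-inverse x x≉0) ⟩
    1# * y           ≈⟨ *-identityˡ y ⟩
    y                ∎

  x≉0∧x*y≈0⇒y≈0 : ∀ {x y} → ¬ x ≈ 0# → x * y ≈ 0# → y ≈ 0#
  x≉0∧x*y≈0⇒y≈0 {x} {y} x≉0 xy≈0 = trans (sym (⁻¹-cancelˡ y x≉0)) (trans (*-congˡ xy≈0) (zeroʳ _))

  infixl 6 _+ₚ_ _-ₚ_
  infixr 7 _·_

  _+ₚ_ : Pol → Pol → Pol
  []      +ₚ q       = q
  (a ∷ p) +ₚ []      = a ∷ p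
  (a ∷ p) +ₚ (b ∷ q) = a + b ∷ p +ₚ q

  _·_ : Carrier → Pol → Pol
  k · p = List.map (k *_) p

  _-ₚ_ : Pol → Pol → Pol
  p -ₚ q = p +ₚ (- 1#) · q

  const : Carrier → Pol
  const a = a ∷ []

  mulAffine : Carrier → Carrier → Pol → Pol
  mulAffine u t p = u · (0# ∷ p) +ₚ t · p

  coeff-+ₚ : ∀ p q n → coeff (p +ₚ q) n ≈ coeff p n + coeff q n
  coeff-+ₚ []      q       n       = sym (+-identityˡ _)
  coeff-+ₚ (a ∷ p) []      n       = sym (+-identityʳ _)
  coeff-+ₚ (a ∷ p) (b ∷ q) zero    = refl
  coeff-+ₚ (a ∷ p) (b ∷ q) (suc n) = coeff-+ₚ p q n

  coeff-· : ∀ k p n → coeff (k · p) n ≈ k * coeff p n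
  coeff-· k []      n       = sym (zeroʳ k)
  coeff-· k (a ∷ p) zero    = refl
  coeff-· k (a ∷ p) (suc n) = coeff-· k p n

  coeff--ₚ : ∀ p q n → coeff (p -ₚ q) n ≈ coeff p n - coeff q n
  coeff--ₚ p q n = trans (coeff-+ₚ p (- 1# · q) n) (+-congˡ (trans (coeff-· (- 1#) q n) (-1*x≈-x _)))

  coeff-mulAffine : ∀ u t p m → coeff (mulAffine u t p) (suc m) ≈ u * coeff p m + t * coeff p (suc m)
  coeff-mulAffine u t p m = trans (coeff-+ₚ (u · (0# ∷ p)) (t · p) (suc m)) (+-cong (coeff-· u (0# ∷ p) (suc m)) (coeff-· t p (suc m)))

  coeff-mulAffine-zero : ∀ u t p → coeff (mulAffine u t p) 0 ≈ u * 0# + t * coeff p 0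
  coeff-mulAffine-zero u t p = trans (coeff-+ₚ (u · (0# ∷ p)) (t · p) 0) (+-cong (coeff-· u (0# ∷ p) 0) (coeff-· t p 0))

  eval-cong : ∀ p {x y} → x ≈ y → eval p x ≈ eval p y
  eval-cong []      x≈y = refl
  eval-cong (a ∷ p) x≈y = +-congˡ (*-cong x≈y (eval-cong p x≈y))

  eval-+ₚ : ∀ p q x → eval (p +ₚ q) x ≈ eval p x + eval q x
  eval-+ₚ []      q       x = sym (+-identityˡ _)
  eval-+ₚ (a ∷ p) []      x = sym (+-identityʳ _)
  eval-+ₚ (a ∷ p) (b ∷ q) x = begin
    (a + b) + x * eval (p +ₚ q) x            ≈⟨ +-congˡ (*-congˡ (eval-+ₚ p q x)) ⟩
    (a + b) + x * (eval p x + eval q x)      ≈⟨ solve 5 (λ a b x P Q → (a :+ b) :+ x :* (P :+ Q) := (a :+ x :* P) :+ (b :+ x :* Q)) refl a b x (eval p x) (eval q x) ⟩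
    (a + x * eval p x) + (b + x * eval q x)  ∎

  eval-· : ∀ k p x → eval (k · p) x ≈ k * eval p x
  eval-· k []      x = sym (zeroʳ k)
  eval-· k (a ∷ p) x = trans (+-congˡ (*-congˡ (eval-· k p x)))
    (solve 4 (λ k a x P → k :* a :+ x :* (k :* P) := k :* (a :+ x :* P)) refl k a x (eval p x))

  eval--ₚ : ∀ p q x → eval (p -ₚ q) x ≈ eval p x - eval q x
  eval--ₚ p q x = trans (eval-+ₚ p (- 1# · q) x) (+-congˡ (trans (eval-· (- 1#) q x) (-1*x≈-x _)))

  eval-const : ∀ a x → eval (const a) x ≈ a
  eval-const a x = trans (+-congˡ (zeroʳ x)) (+-identityʳ a)

  eval-X : ∀ x → eval X x ≈ x
  eval-X x = solve 1 (λ x → con 0ℤ :+ x :* (con 1ℤ :+ x :* con 0ℤ) := x) refl x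

  eval-mulAffine : ∀ u t p x → eval (mulAffine u t p) x ≈ (u * x + t) * eval p x
  eval-mulAffine u t p x = begin
    eval (u · (0# ∷ p) +ₚ t · p) x               ≈⟨ eval-+ₚ (u · (0# ∷ p)) (t · p) x ⟩
    eval (u · (0# ∷ p)) x + eval (t · p) x       ≈⟨ +-cong (eval-· u (0# ∷ p) x) (eval-· t p x) ⟩
    u * (0# + x * eval p x) + t * eval p x       ≈⟨ solve 4 (λ u t x P → u :* (con 0ℤ :+ x :* P) :+ t :* P := (u :* x :+ t) :* P) refl u t x (eval p x) ⟩
    (u * x + t) * eval p x                       ∎

  record DegreeBelow (n : ℕ) (p : Pol) : Set ℓ where
    constructor degreeBelow
    field coeff≈0 : ∀ m → n ℕ.≤ m → coeff p m ≈ 0#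
  open DegreeBelow

  degreeBelow-mono : ∀ {m n p} → m ℕ.≤ n → DegreeBelow m p → DegreeBelow n p
  degreeBelow-mono m≤n h = degreeBelow λ k n≤k → coeff≈0 h k (ℕₚ.≤-trans m≤n n≤k)

  degreeBelow-lower : ∀ {n p} → DegreeBelow (suc n) p → coeff p n ≈ 0# → DegreeBelow n p
  degreeBelow-lower {n} {p} h pₙ≈0 = degreeBelow vanish
    where
    vanish : ∀ m → n ℕ.≤ m → coeff p m ≈ 0#
    vanish m n≤m with ℕₚ.m≤n⇒m<n∨m≡n n≤m
    ... | inj₁ n<m    = coeff≈0 h m n<m
    ... | inj₂ ≡.refl = pₙ≈0

  hasDegree⇒degreeBelow : ∀ p {d} → HasDegree p d → DegreeBelow (suc d) p
  hasDegree⇒degreeBelow p (_ , vanish) = degreeBelow vanish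

  degreeBelow-length : ∀ p → DegreeBelow (length p) p
  degreeBelow-length []      = degreeBelow λ _ _ → refl
  degreeBelow-length (a ∷ p) = degreeBelow λ { (suc m) (s≤s len≤m) → coeff≈0 (degreeBelow-length p) m len≤m }

  const-degreeBelow : ∀ a → DegreeBelow 1 (const a)
  const-degreeBelow a = degreeBelow λ { (suc m) _ → refl }

  ∷-degreeBelow : ∀ {n a p} → DegreeBelow n p → DegreeBelow (suc n) (a ∷ p)
  ∷-degreeBelow h = degreeBelow λ { (suc m) (s≤s n≤m) → coeff≈0 h m n≤m }

  tail-degreeBelow : ∀ {n a p} → DegreeBelow n (a ∷ p) → DegreeBelow (ℕ.pred n) p
  tail-degreeBelow {zero}  h = degreeBelow λ m _ → coeff≈0 h (suc m) z≤n
  tail-degreeBelow {suc n} h = degreeBelow λ m n≤m → coeff≈0 h (suc m) (s≤s n≤m)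

  +ₚ-degreeBelow : ∀ {n p q} → DegreeBelow n p → DegreeBelow n q → DegreeBelow n (p +ₚ q)
  +ₚ-degreeBelow {p = p} {q} hp hq = degreeBelow λ m n≤m →
    trans (coeff-+ₚ p q m) (trans (+-cong (coeff≈0 hp m n≤m) (coeff≈0 hq m n≤m)) (+-identityʳ 0#))

  ·-degreeBelow : ∀ {n} k {p} → DegreeBelow n p → DegreeBelow n (k · p)
  ·-degreeBelow k {p} h = degreeBelow λ m n≤m → trans (coeff-· k p m) (trans (*-congˡ (coeff≈0 h m n≤m)) (zeroʳ k))

  -ₚ-degreeBelow : ∀ {n p q} → DegreeBelow n p → DegreeBelow n q → DegreeBelow n (p -ₚ q)
  -ₚ-degreeBelow hp hq = +ₚ-degreeBelow hp (·-degreeBelow (- 1#) hq)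

  mulAffine-degreeBelow : ∀ {n} u t {p} → DegreeBelow n p → DegreeBelow (suc n) (mulAffine u t p)
  mulAffine-degreeBelow u t h =
    +ₚ-degreeBelow (·-degreeBelow u (∷-degreeBelow h)) (·-degreeBelow t (degreeBelow-mono (ℕₚ.n≤1+n _) h))

  degreeBelow0⇒eval≈0 : ∀ {p} → DegreeBelow 0 p → ∀ x → eval p x ≈ 0#
  degreeBelow0⇒eval≈0 {[]}    h x = refl
  degreeBelow0⇒eval≈0 {a ∷ p} h x = begin
    a + x * eval p x   ≈⟨ +-cong (coeff≈0 h 0 z≤n) (*-congˡ (degreeBelow0⇒eval≈0 (tail-degreeBelow h) x)) ⟩
    0# + x * 0#        ≈⟨ trans (+-identityˡ _) (zeroʳ x) ⟩
    0#                 ∎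

  eval-derivAux-suc : ∀ k p x → eval (derivAux (suc k) p) x ≈ eval (derivAux k p) x + eval p x
  eval-derivAux-suc k []      x = sym (+-identityʳ 0#)
  eval-derivAux-suc k (a ∷ p) x = begin
    (1# + fromℕ k) * a + x * eval (derivAux (suc (suc k)) p) x      ≈⟨ +-congˡ (*-congˡ (eval-derivAux-suc (suc k) p x)) ⟩
    (1# + fromℕ k) * a + x * (eval (derivAux (suc k) p) x + P)       ≈⟨ +-congˡ (*-congˡ (+-congʳ (eval-derivAux-suc k p x))) ⟩
    (1# + fromℕ k) * a + x * ((eval (derivAux k p) x + P) + P)       ≈⟨ solve 5 (λ f a x D P → (con 1ℤ :+ f) :* a :+ x :* ((D :+ P) :+ P) := (f :* a :+ x :* (D :+ P)) :+ (a :+ x :* P)) refl (fromℕ k) a x (eval (derivAux k p) x) P ⟩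
    (fromℕ k * a + x * (eval (derivAux k p) x + P)) + (a + x * P)    ≈⟨ +-congʳ (+-congˡ (*-congˡ (eval-derivAux-suc k p x))) ⟨
    (fromℕ k * a + x * eval (derivAux (suc k) p) x) + (a + x * P)    ∎
    where P = eval p x

  eval-deriv-∷ : ∀ a p x → eval (deriv (a ∷ p)) x ≈ eval p x + x * eval (deriv p) x
  eval-deriv-∷ a []      x = sym (trans (+-identityˡ _) (zeroʳ x))
  eval-deriv-∷ a (b ∷ p) x = begin
    (1# + 0#) * b + x * eval (derivAux 2 p) x                        ≈⟨ +-congˡ (*-congˡ (eval-derivAux-suc 1 p x)) ⟩
    (1# + 0#) * b + x * (eval (derivAux 1 p) x + eval p x)           ≈⟨ solve 4 (λ b x D P → (con 1ℤ :+ con 0ℤ) :* b :+ x :* (D :+ P) := (b :+ x :* P) :+ x :* D) refl b x (eval (derivAux 1 p) x) (eval p x) ⟩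
    (b + x * eval p x) + x * eval (derivAux 1 p) x                   ∎

  eval-deriv-+ₚ : ∀ p q x → eval (deriv (p +ₚ q)) x ≈ eval (deriv p) x + eval (deriv q) x
  eval-deriv-+ₚ []      q       x = sym (+-identityˡ _)
  eval-deriv-+ₚ (a ∷ p) []      x = sym (+-identityʳ _)
  eval-deriv-+ₚ (a ∷ p) (b ∷ q) x = derivAux-+ₚ 1 p q
    where
    derivAux-+ₚ : ∀ k p q → eval (derivAux k (p +ₚ q)) x ≈ eval (derivAux k p) x + eval (derivAux k q) x
    derivAux-+ₚ k []      q       = sym (+-identityˡ _)
    derivAux-+ₚ k (a ∷ p) []      = sym (+-identityʳ _)
    derivAux-+ₚ k (a ∷ p) (b ∷ q) = trans (+-congˡ (*-congˡ (derivAux-+ₚ (suc k) p q)))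
      (solve 6 (λ f a b x P Q → f :* (a :+ b) :+ x :* (P :+ Q) := (f :* a :+ x :* P) :+ (f :* b :+ x :* Q)) refl
        (fromℕ k) a b x (eval (derivAux (suc k) p) x) (eval (derivAux (suc k) q) x))

  eval-deriv-· : ∀ c p x → eval (deriv (c · p)) x ≈ c * eval (deriv p) x
  eval-deriv-· c []      x = sym (zeroʳ c)
  eval-deriv-· c (a ∷ p) x = derivAux-· 1 p
    where
    derivAux-· : ∀ k p → eval (derivAux k (c · p)) x ≈ c * eval (derivAux k p) x
    derivAux-· k []      = sym (zeroʳ c)
    derivAux-· k (a ∷ p) = trans (+-congˡ (*-congˡ (derivAux-· (suc k) p)))
      (solve 5 (λ f c a x P → f :* (c :* a) :+ x :* (c :* P) := c :* (f :* a :+ x :* P)) refl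
        (fromℕ k) c a x (eval (derivAux (suc k) p) x))

  coeff-deriv : ∀ p n → coeff (deriv p) n ≈ fromℕ (suc n) * coeff p (suc n)
  coeff-deriv []      n = sym (zeroʳ _)
  coeff-deriv (a ∷ p) n = coeff-derivAux 1 p n
    where
    coeff-derivAux : ∀ k p n → coeff (derivAux k p) n ≈ fromℕ (k ℕ.+ n) * coeff p n
    coeff-derivAux k []      n       = sym (zeroʳ _)
    coeff-derivAux k (a ∷ p) zero    = *-congʳ (reflexive (≡.cong fromℕ (≡.sym (ℕₚ.+-identityʳ k))))
    coeff-derivAux k (a ∷ p) (suc n) = trans (coeff-derivAux (suc k) p n) (*-congʳ (reflexive (≡.cong fromℕ (≡.sym (ℕₚ.+-suc k n)))))

  deriv-degreeBelow : ∀ {n p} → DegreeBelow (suc n) p → DegreeBelow n (deriv p)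
  deriv-degreeBelow {p = p} h = degreeBelow λ m n≤m →
    trans (coeff-deriv p m) (trans (*-congˡ (coeff≈0 h (suc m) (s≤s n≤m))) (zeroʳ _))

  divByLinear : Carrier → Pol → Pol
  divByLinear r []          = []
  divByLinear r (a ∷ [])    = []
  divByLinear r (a ∷ b ∷ p) = eval (b ∷ p) r ∷ divByLinear r (b ∷ p)

  eval-divByLinear : ∀ r p x → eval p x ≈ (x - r) * eval (divByLinear r p) x + eval p r
  eval-divByLinear r []          x = sym (trans (+-identityʳ _) (zeroʳ _))
  eval-divByLinear r (a ∷ [])    x = solve 3 (λ a x r → a :+ x :* con 0ℤ := (x :- r) :* con 0ℤ :+ (a :+ r :* con 0ℤ)) refl a x r
  eval-divByLinear r (a ∷ b ∷ p) x = begin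
    a + x * eval (b ∷ p) x              ≈⟨ +-congˡ (*-congˡ (eval-divByLinear r (b ∷ p) x)) ⟩
    a + x * ((x - r) * Q + E)           ≈⟨ solve 5 (λ a x r Q E → a :+ x :* ((x :- r) :* Q :+ E) := (x :- r) :* (E :+ x :* Q) :+ (a :+ r :* E)) refl a x r Q E ⟩
    (x - r) * (E + x * Q) + (a + r * E) ∎
    where
    Q = eval (divByLinear r (b ∷ p)) x
    E = eval (b ∷ p) r

  eval-divByLinear-head : ∀ r p → eval p r ≈ coeff p 0 + r * coeff (divByLinear r p) 0
  eval-divByLinear-head r []          = sym (trans (+-identityˡ _) (zeroʳ r))
  eval-divByLinear-head r (a ∷ [])    = refl
  eval-divByLinear-head r (a ∷ b ∷ p) = refl

  coeff-divByLinear : ∀ r p m → coeff (divByLinear r p) m ≈ coeff p (suc m) + r * coeff (divByLinear r p) (suc m)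
  coeff-divByLinear r []          m       = sym (trans (+-identityˡ _) (zeroʳ r))
  coeff-divByLinear r (a ∷ [])    m       = sym (trans (+-identityˡ _) (zeroʳ r))
  coeff-divByLinear r (a ∷ b ∷ p) zero    = eval-divByLinear-head r (b ∷ p)
  coeff-divByLinear r (a ∷ b ∷ p) (suc m) = coeff-divByLinear r (b ∷ p) m

  divByLinear-degreeBelow : ∀ {n} r p → DegreeBelow (suc n) p → DegreeBelow n (divByLinear r p)
  divByLinear-degreeBelow r p h = degreeBelow (vanish r p h)
    where
    vanish : ∀ {n} r p → DegreeBelow (suc n) p → ∀ m → n ℕ.≤ m → coeff (divByLinear r p) m ≈ 0#
    vanish         r []          h m       _         = refl
    vanish         r (a ∷ [])    h m       _         = refl
    vanish {zero}  r (a ∷ b ∷ p) h zero    _         = degreeBelow0⇒eval≈0 (tail-degreeBelow h) r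
    vanish {zero}  r (a ∷ b ∷ p) h (suc m) _         = vanish r (b ∷ p) (degreeBelow-mono z≤n (tail-degreeBelow h)) m z≤n
    vanish {suc n} r (a ∷ b ∷ p) h (suc m) (s≤s n≤m) = vanish r (b ∷ p) (tail-degreeBelow h) m n≤m

  Distinct : ∀ {n} → (Fin n → Carrier) → Set ℓ
  Distinct r = ∀ i j → i ≢ j → ¬ r i ≈ r j

  distinctRoots⇒degreeBelow0 : ∀ {n p} (r : Fin n → Carrier) → Distinct r →
    (∀ i → eval p (r i) ≈ 0#) → DegreeBelow n p → DegreeBelow 0 p
  distinctRoots⇒degreeBelow0 {zero}      r distinct roots h = h
  distinctRoots⇒degreeBelow0 {suc n} {p} r distinct roots h = degreeBelow λ
    { zero    _ → cancel (eval-divByLinear-head r₀ p) (roots fzero) (coeff≈0 q≈0 0 z≤n)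
    ; (suc m) _ → cancel (coeff-divByLinear r₀ p m) (coeff≈0 q≈0 m z≤n) (coeff≈0 q≈0 (suc m) z≤n) }
    where
    r₀ = r fzero
    q  = divByLinear r₀ p

    cancel : ∀ {s a t} → s ≈ a + r₀ * t → s ≈ 0# → t ≈ 0# → a ≈ 0#
    cancel {s} {a} {t} s≈a+r₀t s≈0 t≈0 = begin
      a             ≈⟨ trans (+-congˡ (zeroʳ r₀)) (+-identityʳ a) ⟨
      a + r₀ * 0#   ≈⟨ +-congˡ (*-congˡ t≈0) ⟨
      a + r₀ * t    ≈⟨ s≈a+r₀t ⟨
      s             ≈⟨ s≈0 ⟩
      0#            ∎

    q-root : ∀ i → eval q (r (fsuc i)) ≈ 0#
    q-root i = x≉0∧x*y≈0⇒y≈0 x-r₀≉0 (begin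
      (x - r₀) * eval q x            ≈⟨ trans (+-congˡ (roots fzero)) (+-identityʳ _) ⟨
      (x - r₀) * eval q x + eval p r₀ ≈⟨ eval-divByLinear r₀ p x ⟨
      eval p x                       ≈⟨ roots (fsuc i) ⟩
      0#                             ∎)
      where
      x = r (fsuc i)
      x-r₀≉0 : ¬ x - r₀ ≈ 0#
      x-r₀≉0 x-r₀≈0 = distinct (fsuc i) fzero (λ ()) (x∙y⁻¹≈ε⇒x≈y x r₀ x-r₀≈0)

    q≈0 : DegreeBelow 0 q
    q≈0 = distinctRoots⇒degreeBelow0 (λ i → r (fsuc i))
      (λ i j i≢j → distinct (fsuc i) (fsuc j) (λ eq → i≢j (Finₚ.suc-injective eq)))
      q-root (divByLinear-degreeBelow r₀ p h)

  Infinite : Set (c ⊔ ℓ)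
  Infinite = ∀ n (f : Fin n → Carrier) → ∃ λ z → ∀ i → ¬ z ≈ f i

  vanishingPolynomial : ∀ n → (Fin n → Carrier) → Pol
  vanishingPolynomial zero    f = const 1#
  vanishingPolynomial (suc n) f = mulAffine 1# (- f fzero) (vanishingPolynomial n (λ i → f (fsuc i)))

  vanishingPolynomial-root : ∀ n f i → eval (vanishingPolynomial n f) (f i) ≈ 0#
  vanishingPolynomial-root (suc n) f fzero = begin
    eval (vanishingPolynomial (suc n) f) (f fzero) ≈⟨ eval-mulAffine 1# (- f fzero) P (f fzero) ⟩
    (1# * f fzero + - f fzero) * eval P (f fzero)  ≈⟨ solve 2 (λ c Q → (con 1ℤ :* c :+ :- c) :* Q := con 0ℤ) refl (f fzero) (eval P (f fzero)) ⟩
    0#                                             ∎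
    where P = vanishingPolynomial n (λ i → f (fsuc i))
  vanishingPolynomial-root (suc n) f (fsuc i) = begin
    eval (vanishingPolynomial (suc n) f) x ≈⟨ eval-mulAffine 1# (- f fzero) P x ⟩
    (1# * x + - f fzero) * eval P x        ≈⟨ *-congˡ (vanishingPolynomial-root n (λ i → f (fsuc i)) i) ⟩
    (1# * x + - f fzero) * 0#              ≈⟨ zeroʳ _ ⟩
    0#                                     ∎
    where
    x = f (fsuc i)
    P = vanishingPolynomial n (λ i → f (fsuc i))

  vanishingPolynomial-monic : ∀ n f → coeff (vanishingPolynomial n f) n ≈ 1# × DegreeBelow (suc n) (vanishingPolynomial n f)
  vanishingPolynomial-monic zero    f = refl , const-degreeBelow 1#
  vanishingPolynomial-monic (suc n) f = leading , mulAffine-degreeBelow 1# (- f fzero) P-degree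
    where
    P = vanishingPolynomial n (λ i → f (fsuc i))
    P-monic = vanishingPolynomial-monic n (λ i → f (fsuc i))
    P-degree = proj₂ P-monic
    leading : coeff (vanishingPolynomial (suc n) f) (suc n) ≈ 1#
    leading = begin
      coeff (mulAffine 1# (- f fzero) P) (suc n)          ≈⟨ coeff-mulAffine 1# (- f fzero) P n ⟩
      1# * coeff P n + - f fzero * coeff P (suc n)        ≈⟨ +-cong (*-congˡ (proj₁ P-monic)) (*-congˡ (coeff≈0 P-degree (suc n) ℕₚ.≤-refl)) ⟩
      1# * 1# + - f fzero * 0#                            ≈⟨ solve 1 (λ c → con 1ℤ :* con 1ℤ :+ c :* con 0ℤ := con 1ℤ) refl (- f fzero) ⟩
      1#                                                  ∎

  -- a root of 1 + x ∏ᵢ (x - f i) avoids every f i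
  algClosed⇒infinite : AlgClosed → Infinite
  algClosed⇒infinite algClosed n f = z , z≉f
    where
    P = vanishingPolynomial n f
    Q = const 1# +ₚ (0# ∷ P)

    Q-degree : HasDegree Q (suc n)
    Q-degree = Q-leading≉0 , coeff≈0 (+ₚ-degreeBelow (degreeBelow-mono (s≤s z≤n) (const-degreeBelow 1#)) (∷-degreeBelow (proj₂ (vanishingPolynomial-monic n f))))
      where
      Q-leading≉0 : ¬ coeff Q (suc n) ≈ 0#
      Q-leading≉0 Qₙ≈0 = 1#≉0# (begin
        1#                ≈⟨ proj₁ (vanishingPolynomial-monic n f) ⟨
        coeff P n         ≈⟨ +-identityˡ _ ⟨
        0# + coeff P n    ≈⟨ coeff-+ₚ (const 1#) (0# ∷ P) (suc n) ⟨
        coeff Q (suc n)   ≈⟨ Qₙ≈0 ⟩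
        0#                ∎)

    root = algClosed Q (suc n) (s≤s z≤n) Q-degree
    z = proj₁ root

    z≉f : ∀ i → ¬ z ≈ f i
    z≉f i z≈fi = 1#≉0# (begin
      1#                                                ≈⟨ solve 2 (λ z P → con 1ℤ := con 1ℤ :+ (con 0ℤ :+ z :* P) :- z :* P) refl z (eval P z) ⟩
      1# + (0# + z * eval P z) - z * eval P z           ≈⟨ +-cong (+-congʳ (eval-const 1# z)) (-‿cong (*-congˡ (sym Pz≈0))) ⟨
      eval (const 1#) z + (0# + z * eval P z) - z * 0#  ≈⟨ +-cong (eval-+ₚ (const 1#) (0# ∷ P) z) (-‿cong (sym (zeroʳ z))) ⟨
      eval Q z - 0#                                     ≈⟨ +-cong (proj₂ root) -0#≈0# ⟩
      0# + 0#                                           ≈⟨ +-identityʳ 0# ⟩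
      0#                                                ∎)
      where Pz≈0 = trans (eval-cong P z≈fi) (vanishingPolynomial-root n f i)

  distinctPoints : Infinite → ∀ n → Σ (Fin n → Carrier) Distinct
  distinctPoints infinite zero    = (λ ()) , λ ()
  distinctPoints infinite (suc n) = f , f-distinct
    where
    g = distinctPoints infinite n
    new = infinite n (proj₁ g)

    f : Fin (suc n) → Carrier
    f fzero    = proj₁ new
    f (fsuc i) = proj₁ g i

    f-distinct : Distinct f
    f-distinct fzero    fzero    i≢j = ⊥-elim (i≢j ≡.refl)
    f-distinct fzero    (fsuc j) _   = proj₂ new j
    f-distinct (fsuc i) fzero    _   = λ eq → proj₂ new i (sym eq)
    f-distinct (fsuc i) (fsuc j) i≢j = proj₂ g i j (λ eq → i≢j (≡.cong fsuc eq))

  eval≗⇒≈ₚ : Infinite → ∀ p q → (∀ x → eval p x ≈ eval q x) → p ≈ₚ q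
  eval≗⇒≈ₚ infinite p q p≗q n = x∙y⁻¹≈ε⇒x≈y _ _ (trans (sym (coeff--ₚ p q n)) (coeff≈0 r≈0 n z≤n))
    where
    r = p -ₚ q
    points = distinctPoints infinite (length r)
    r≈0 : DegreeBelow 0 r
    r≈0 = distinctRoots⇒degreeBelow0 (proj₁ points) (proj₂ points)
      (λ i → trans (eval--ₚ p q _) (x≈y⇒x∙y⁻¹≈ε (p≗q _))) (degreeBelow-length r)

  eval-deriv-mulAffine : ∀ u t p x → eval (deriv (mulAffine u t p)) x ≈ u * eval p x + (u * x + t) * eval (deriv p) x
  eval-deriv-mulAffine u t p x = begin
    eval (deriv (u · (0# ∷ p) +ₚ t · p)) x                    ≈⟨ eval-deriv-+ₚ (u · (0# ∷ p)) (t · p) x ⟩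
    eval (deriv (u · (0# ∷ p))) x + eval (deriv (t · p)) x    ≈⟨ +-cong (eval-deriv-· u (0# ∷ p) x) (eval-deriv-· t p x) ⟩
    u * eval (deriv (0# ∷ p)) x + t * eval (deriv p) x        ≈⟨ +-congʳ (*-congˡ (eval-deriv-∷ 0# p x)) ⟩
    u * (eval p x + x * eval (deriv p) x) + t * eval (deriv p) x
      ≈⟨ solve 5 (λ u t x P D → u :* (P :+ x :* D) :+ t :* D := u :* P :+ (u :* x :+ t) :* D) refl u t x (eval p x) (eval (deriv p) x) ⟩
    u * eval p x + (u * x + t) * eval (deriv p) x             ∎

  compAffine : Carrier → Carrier → Pol → Pol
  compAffine u t []      = []
  compAffine u t (a ∷ p) = const a +ₚ mulAffine u t (compAffine u t p)

  eval-compAffine : ∀ u t p x → eval (compAffine u t p) x ≈ eval p (u * x + t)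
  eval-compAffine u t []      x = refl
  eval-compAffine u t (a ∷ p) x = begin
    eval (const a +ₚ mulAffine u t C) x             ≈⟨ eval-+ₚ (const a) (mulAffine u t C) x ⟩
    eval (const a) x + eval (mulAffine u t C) x     ≈⟨ +-cong (eval-const a x) (eval-mulAffine u t C x) ⟩
    a + (u * x + t) * eval C x                      ≈⟨ +-congˡ (*-congˡ (eval-compAffine u t p x)) ⟩
    a + (u * x + t) * eval p (u * x + t)            ∎
    where C = compAffine u t p

  eval-deriv-compAffine : ∀ u t p x → eval (deriv (compAffine u t p)) x ≈ u * eval (deriv p) (u * x + t)
  eval-deriv-compAffine u t []      x = sym (zeroʳ u)
  eval-deriv-compAffine u t (a ∷ p) x = begin
    eval (deriv (const a +ₚ mulAffine u t C)) x                   ≈⟨ eval-deriv-+ₚ (const a) (mulAffine u t C) x ⟩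
    0# + eval (deriv (mulAffine u t C)) x                         ≈⟨ +-identityˡ _ ⟩
    eval (deriv (mulAffine u t C)) x                              ≈⟨ eval-deriv-mulAffine u t C x ⟩
    u * eval C x + w * eval (deriv C) x                           ≈⟨ +-cong (*-congˡ (eval-compAffine u t p x)) (*-congˡ (eval-deriv-compAffine u t p x)) ⟩
    u * eval p w + w * (u * eval (deriv p) w)                     ≈⟨ solve 4 (λ u w P D → u :* P :+ w :* (u :* D) := u :* (P :+ w :* D)) refl u w (eval p w) (eval (deriv p) w) ⟩
    u * (eval p w + w * eval (deriv p) w)                         ≈⟨ *-congˡ (eval-deriv-∷ a p w) ⟨
    u * eval (deriv (a ∷ p)) w                                    ∎
    where
    C = compAffine u t p
    w = u * x + t

  coeff-compAffine-zero : ∀ u t a p → coeff (compAffine u t (a ∷ p)) 0 ≈ a + (u * 0# + t * coeff (compAffine u t p) 0)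
  coeff-compAffine-zero u t a p = trans (coeff-+ₚ (const a) (mulAffine u t (compAffine u t p)) 0) (+-congˡ (coeff-mulAffine-zero u t (compAffine u t p)))

  coeff-compAffine-suc : ∀ u t a p m →
    coeff (compAffine u t (a ∷ p)) (suc m) ≈ 0# + (u * coeff (compAffine u t p) m + t * coeff (compAffine u t p) (suc m))
  coeff-compAffine-suc u t a p m = trans (coeff-+ₚ (const a) (mulAffine u t (compAffine u t p)) (suc m)) (+-congˡ (coeff-mulAffine u t (compAffine u t p) m))

  compAffine-degreeBelow : ∀ u t {n} p → DegreeBelow n p → DegreeBelow n (compAffine u t p)
  compAffine-degreeBelow u t     []      h = degreeBelow λ _ _ → refl
  compAffine-degreeBelow u t {n} (a ∷ p) h = degreeBelow vanish
    where
    C-degree = compAffine-degreeBelow u t p (tail-degreeBelow h)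
    C≈0 : ∀ {m} → ℕ.pred n ℕ.≤ m → coeff (compAffine u t p) m ≈ 0#
    C≈0 = coeff≈0 C-degree _

    vanish : ∀ m → n ℕ.≤ m → coeff (compAffine u t (a ∷ p)) m ≈ 0#
    vanish zero    n≤0   = trans (coeff-compAffine-zero u t a p)
      (trans (+-cong (coeff≈0 h 0 n≤0) (+-cong (zeroʳ u) (trans (*-congˡ (C≈0 (ℕₚ.pred-mono-≤ n≤0))) (zeroʳ t))))
             (trans (+-identityˡ _) (+-identityʳ 0#)))
    vanish (suc m) n≤1+m = trans (coeff-compAffine-suc u t a p m)
      (trans (+-congˡ (+-cong (*-congˡ (C≈0 (ℕₚ.pred-mono-≤ n≤1+m))) (*-congˡ (C≈0 (ℕₚ.≤-trans ℕₚ.pred[n]≤n n≤1+m)))))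
             (solve 2 (λ u t → con 0ℤ :+ (u :* con 0ℤ :+ t :* con 0ℤ) := con 0ℤ) refl u t))

  coeff-compAffine-leading : ∀ u t m p → DegreeBelow (suc m) p → coeff (compAffine u t p) m ≈ u ^ m * coeff p m
  coeff-compAffine-leading u t m       []      h = sym (zeroʳ _)
  coeff-compAffine-leading u t zero    (a ∷ p) h = begin
    coeff (compAffine u t (a ∷ p)) 0                 ≈⟨ coeff-compAffine-zero u t a p ⟩
    a + (u * 0# + t * coeff (compAffine u t p) 0)    ≈⟨ +-congˡ (+-congˡ (*-congˡ (coeff≈0 (compAffine-degreeBelow u t p (tail-degreeBelow h)) 0 z≤n))) ⟩
    a + (u * 0# + t * 0#)                            ≈⟨ solve 3 (λ a u t → a :+ (u :* con 0ℤ :+ t :* con 0ℤ) := con 1ℤ :* a) refl a u t ⟩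
    1# * a                                           ∎
  coeff-compAffine-leading u t (suc m) (a ∷ p) h = begin
    coeff (compAffine u t (a ∷ p)) (suc m)           ≈⟨ coeff-compAffine-suc u t a p m ⟩
    0# + (u * coeff C m + t * coeff C (suc m))       ≈⟨ +-congˡ (+-cong (*-congˡ (coeff-compAffine-leading u t m p p-degree))
                                                                         (*-congˡ (coeff≈0 (compAffine-degreeBelow u t p p-degree) (suc m) ℕₚ.≤-refl))) ⟩
    0# + (u * (u ^ m * coeff p m) + t * 0#)          ≈⟨ solve 4 (λ u U c t → con 0ℤ :+ (u :* (U :* c) :+ t :* con 0ℤ) := (u :* U) :* c) refl u (u ^ m) (coeff p m) t ⟩
    u * u ^ m * coeff p m                            ∎
    where
    C = compAffine u t p
    p-degree = tail-degreeBelow h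

  1#^n≈1# : ∀ n → 1# ^ n ≈ 1#
  1#^n≈1# zero    = refl
  1#^n≈1# (suc n) = trans (*-congˡ (1#^n≈1# n)) (*-identityˡ 1#)

  monomial : ℕ → Pol
  monomial zero    = const 1#
  monomial (suc n) = 0# ∷ monomial n

  eval-monomial : ∀ n x → eval (monomial n) x ≈ x ^ n
  eval-monomial zero    x = eval-const 1# x
  eval-monomial (suc n) x = trans (+-identityˡ _) (*-congˡ (eval-monomial n x))

  coeff-monomial : ∀ n → coeff (monomial n) n ≡ 1#
  coeff-monomial zero    = ≡.refl
  coeff-monomial (suc n) = coeff-monomial n

  monomial-degreeBelow : ∀ n → DegreeBelow (suc n) (monomial n)
  monomial-degreeBelow zero    = const-degreeBelow 1#
  monomial-degreeBelow (suc n) = ∷-degreeBelow (monomial-degreeBelow n)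

  algClosed⇒root : AlgClosed → ∀ n a → ∃ λ α → α ^ suc n ≈ a
  algClosed⇒root algClosed n a = α , x∙y⁻¹≈ε⇒x≈y _ _ (begin
    α ^ suc n - a                                   ≈⟨ +-cong (eval-monomial (suc n) α) (-‿cong (eval-const a α)) ⟨
    eval (monomial (suc n)) α - eval (const a) α    ≈⟨ eval--ₚ (monomial (suc n)) (const a) α ⟨
    eval Q α                                        ≈⟨ proj₂ root ⟩
    0#                                              ∎)
    where
    Q = monomial (suc n) -ₚ const a

    Q-leading≉0 : ¬ coeff Q (suc n) ≈ 0#
    Q-leading≉0 Qₙ≈0 = 1#≉0# (begin
      1#                                     ≈⟨ reflexive (coeff-monomial (suc n)) ⟨
      coeff (monomial (suc n)) (suc n)       ≈⟨ trans (+-congˡ -0#≈0#) (+-identityʳ _) ⟨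
      coeff (monomial (suc n)) (suc n) - 0#  ≈⟨ coeff--ₚ (monomial (suc n)) (const a) (suc n) ⟨
      coeff Q (suc n)                        ≈⟨ Qₙ≈0 ⟩
      0#                                     ∎)

    root = algClosed Q (suc n) (s≤s z≤n)
      (Q-leading≉0 , coeff≈0 (-ₚ-degreeBelow (monomial-degreeBelow (suc n)) (degreeBelow-mono (s≤s z≤n) (const-degreeBelow a))))
    α = proj₁ root

  cfsr-degree≉0 : Infinite → ∀ φ {k} → IsCFSRDeg φ (suc (suc k)) → ¬ fromℕ (suc (suc k)) ≈ 0#
  cfsr-degree≉0 infinite φ {k} (_ , φ-degree , crit , distinct , critical , _ , onlyCritical) d≈0 =
    proj₂ z (proj₁ w) (proj₂ w)
    where
    φ'-degree : DegreeBelow (suc k) (deriv φ)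
    φ'-degree = degreeBelow-lower (deriv-degreeBelow (hasDegree⇒degreeBelow φ φ-degree))
      (trans (coeff-deriv φ (suc k)) (trans (*-congʳ d≈0) (zeroˡ _)))
    z = infinite (suc k) crit
    w = onlyCritical (proj₁ z) (degreeBelow0⇒eval≈0 (distinctRoots⇒degreeBelow0 crit distinct critical φ'-degree) (proj₁ z))

  X-degreeBelow : DegreeBelow 2 X
  X-degreeBelow = degreeBelow λ { (suc (suc m)) _ → refl ; (suc zero) (s≤s ()) }

  -- H = d (φ - x) - (x - e) φ' loses its x^d term automatically and its x^(d-1) term by the choice of e.
  cfsr-fixedPointIdentity : ∀ φ {k} → IsCFSRDeg φ (suc (suc k)) → ¬ fromℕ (suc (suc k)) ≈ 0# →
    ∃ λ e → ∀ x → fromℕ (suc (suc k)) * (eval φ x - x) ≈ (x - e) * eval (deriv φ) x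
  cfsr-fixedPointIdentity φ {k} (_ , φ-degree@(a≉0 , _) , crit , distinct , critical , fixed , _) δ≉0 = e , identity
    where
    d = suc (suc k)
    δ = fromℕ d
    a = coeff φ d
    φ' = deriv φ

    H₀ : Pol
    H₀ = δ · (φ -ₚ X) -ₚ (0# ∷ φ')

    e : Carrier
    e = - coeff H₀ (suc k) * (δ * a) ⁻¹

    H : Pol
    H = H₀ +ₚ e · φ'

    φ'-degree : DegreeBelow d φ'
    φ'-degree = deriv-degreeBelow (hasDegree⇒degreeBelow φ φ-degree)

    H₀-degree : DegreeBelow d H₀
    H₀-degree = degreeBelow-lower
      (-ₚ-degreeBelow (·-degreeBelow δ (-ₚ-degreeBelow (hasDegree⇒degreeBelow φ φ-degree) (degreeBelow-mono (s≤s (s≤s z≤n)) X-degreeBelow)))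
                      (∷-degreeBelow φ'-degree))
      (begin
        coeff H₀ d                                   ≈⟨ coeff--ₚ (δ · (φ -ₚ X)) (0# ∷ φ') d ⟩
        coeff (δ · (φ -ₚ X)) d - coeff φ' (suc k)    ≈⟨ +-cong (trans (coeff-· δ (φ -ₚ X) d) (*-congˡ (coeff--ₚ φ X d))) (-‿cong (coeff-deriv φ (suc k))) ⟩
        δ * (a - 0#) - δ * a                         ≈⟨ solve 2 (λ δ a → δ :* (a :- con 0ℤ) :- δ :* a := con 0ℤ) refl δ a ⟩
        0#                                           ∎)

    H-degree : DegreeBelow (suc k) H
    H-degree = degreeBelow-lower (+ₚ-degreeBelow H₀-degree (·-degreeBelow e φ'-degree)) (begin
      coeff H (suc k)                           ≈⟨ trans (coeff-+ₚ H₀ (e · φ') (suc k)) (+-congˡ (coeff-· e φ' (suc k))) ⟩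
      C + e * coeff φ' (suc k)                  ≈⟨ +-congˡ (*-congˡ (coeff-deriv φ (suc k))) ⟩
      C + (- C * (δ * a) ⁻¹) * (δ * a)          ≈⟨ solve 3 (λ C A A⁻¹ → C :+ (:- C :* A⁻¹) :* A := C :- C :* (A :* A⁻¹)) refl C (δ * a) ((δ * a) ⁻¹) ⟩
      C - C * ((δ * a) * (δ * a) ⁻¹)            ≈⟨ +-congˡ (-‿cong (*-congˡ (⁻¹-inverse (δ * a) δa≉0))) ⟩
      C - C * 1#                                ≈⟨ solve 1 (λ C → C :- C :* con 1ℤ := con 0ℤ) refl C ⟩
      0#                                        ∎)
      where
      C = coeff H₀ (suc k)
      δa≉0 : ¬ δ * a ≈ 0#
      δa≉0 δa≈0 = a≉0 (x≉0∧x*y≈0⇒y≈0 δ≉0 δa≈0)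

    eval-H : ∀ x → eval H x ≈ δ * (eval φ x - x) - (x - e) * eval φ' x
    eval-H x = begin
      eval H x                                               ≈⟨ eval-+ₚ H₀ (e · φ') x ⟩
      eval H₀ x + eval (e · φ') x                            ≈⟨ +-cong (eval--ₚ (δ · (φ -ₚ X)) (0# ∷ φ') x) (eval-· e φ' x) ⟩
      eval (δ · (φ -ₚ X)) x - (0# + x * eval φ' x) + e * eval φ' x
        ≈⟨ +-congʳ (+-congʳ (trans (eval-· δ (φ -ₚ X) x) (*-congˡ (trans (eval--ₚ φ X x) (+-congˡ (-‿cong (eval-X x))))))) ⟩
      δ * (eval φ x - x) - (0# + x * eval φ' x) + e * eval φ' x
        ≈⟨ solve 5 (λ δ P x e D → δ :* (P :- x) :- (con 0ℤ :+ x :* D) :+ e :* D := δ :* (P :- x) :- (x :- e) :* D) refl δ (eval φ x) x e (eval φ' x) ⟩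
      δ * (eval φ x - x) - (x - e) * eval φ' x               ∎

    H-root : ∀ i → eval H (crit i) ≈ 0#
    H-root i = begin
      eval H (crit i)                                            ≈⟨ eval-H (crit i) ⟩
      δ * (eval φ (crit i) - crit i) - (crit i - e) * eval φ' (crit i)  ≈⟨ +-cong (*-congˡ (+-congʳ (fixed i))) (-‿cong (*-congˡ (critical i))) ⟩
      δ * (crit i - crit i) - (crit i - e) * 0#                  ≈⟨ solve 3 (λ δ c e → δ :* (c :- c) :- (c :- e) :* con 0ℤ := con 0ℤ) refl δ (crit i) e ⟩
      0#                                                         ∎

    identity : ∀ x → δ * (eval φ x - x) ≈ (x - e) * eval φ' x
    identity x = x∙y⁻¹≈ε⇒x≈y _ _ (trans (sym (eval-H x))
      (degreeBelow0⇒eval≈0 (distinctRoots⇒degreeBelow0 crit distinct H-root H-degree) x))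

  module Conjugation (α : Carrier) (α≉0 : ¬ α ≈ 0#) (e : Carrier) where
    β : Carrier
    β = - (α * e)

    γ γ⁻¹ : Carrier → Carrier
    γ   x = α * x + β
    γ⁻¹ y = α ⁻¹ * y + e

    γ-cong : ∀ {x y} → x ≈ y → γ x ≈ γ y
    γ-cong x≈y = +-congʳ (*-congˡ x≈y)

    γ⁻¹-cong : ∀ {x y} → x ≈ y → γ⁻¹ x ≈ γ⁻¹ y
    γ⁻¹-cong x≈y = +-congʳ (*-congˡ x≈y)

    γ⁻¹∘γ : ∀ x → γ⁻¹ (γ x) ≈ x
    γ⁻¹∘γ x = begin
      α ⁻¹ * (α * x + - (α * e)) + e  ≈⟨ +-congʳ (*-congˡ (solve 3 (λ α x e → α :* x :+ :- (α :* e) := α :* (x :- e)) refl α x e)) ⟩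
      α ⁻¹ * (α * (x - e)) + e        ≈⟨ +-congʳ (⁻¹-cancelˡ (x - e) α≉0) ⟩
      (x - e) + e                     ≈⟨ solve 2 (λ x e → (x :- e) :+ e := x) refl x e ⟩
      x                               ∎

    γ∘γ⁻¹ : ∀ y → γ (γ⁻¹ y) ≈ y
    γ∘γ⁻¹ y = begin
      α * (α ⁻¹ * y + e) + - (α * e)  ≈⟨ solve 4 (λ α α⁻¹ y e → α :* (α⁻¹ :* y :+ e) :+ :- (α :* e) := (α :* α⁻¹) :* y) refl α (α ⁻¹) y e ⟩
      (α * α ⁻¹) * y                  ≈⟨ *-congʳ (⁻¹-inverse α α≉0) ⟩
      1# * y                          ≈⟨ *-identityˡ y ⟩
      y                               ∎

    conj : Pol → Pol
    conj φ = α · compAffine (α ⁻¹) e φ +ₚ const β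

    eval-conj : ∀ φ y → eval (conj φ) y ≈ γ (eval φ (γ⁻¹ y))
    eval-conj φ y = begin
      eval (conj φ) y                                         ≈⟨ eval-+ₚ (α · compAffine (α ⁻¹) e φ) (const β) y ⟩
      eval (α · compAffine (α ⁻¹) e φ) y + eval (const β) y   ≈⟨ +-cong (trans (eval-· α (compAffine (α ⁻¹) e φ) y) (*-congˡ (eval-compAffine (α ⁻¹) e φ y))) (eval-const β y) ⟩
      γ (eval φ (γ⁻¹ y))                                      ∎

    eval-deriv-conj : ∀ φ y → eval (deriv (conj φ)) y ≈ eval (deriv φ) (γ⁻¹ y)
    eval-deriv-conj φ y = begin
      eval (deriv (conj φ)) y                               ≈⟨ eval-deriv-+ₚ (α · compAffine (α ⁻¹) e φ) (const β) y ⟩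
      eval (deriv (α · compAffine (α ⁻¹) e φ)) y + 0#       ≈⟨ +-identityʳ _ ⟩
      eval (deriv (α · compAffine (α ⁻¹) e φ)) y            ≈⟨ eval-deriv-· α (compAffine (α ⁻¹) e φ) y ⟩
      α * eval (deriv (compAffine (α ⁻¹) e φ)) y            ≈⟨ *-congˡ (eval-deriv-compAffine (α ⁻¹) e φ y) ⟩
      α * (α ⁻¹ * eval (deriv φ) (γ⁻¹ y))                   ≈⟨ solve 3 (λ α α⁻¹ D → α :* (α⁻¹ :* D) := (α :* α⁻¹) :* D) refl α (α ⁻¹) _ ⟩
      (α * α ⁻¹) * eval (deriv φ) (γ⁻¹ y)                   ≈⟨ trans (*-congʳ (⁻¹-inverse α α≉0)) (*-identityˡ _) ⟩
      eval (deriv φ) (γ⁻¹ y)                                ∎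

    conj-monic : ∀ φ {m} → HasDegree φ (suc m) → α ^ m ≈ coeff φ (suc m) → MonicDeg (conj φ) (suc m)
    conj-monic φ {m} φ-degree αᵐ≈a = ((λ ψₘ≈0 → 1#≉0# (trans (sym leading) ψₘ≈0)) , coeff≈0 ψ-degree) , leading
      where
      u = α ⁻¹
      ψ-degree : DegreeBelow (suc (suc m)) (conj φ)
      ψ-degree = +ₚ-degreeBelow (·-degreeBelow α (compAffine-degreeBelow u e φ (hasDegree⇒degreeBelow φ φ-degree)))
                                (degreeBelow-mono (s≤s z≤n) (const-degreeBelow β))
      leading : coeff (conj φ) (suc m) ≈ 1#
      leading = begin
        coeff (conj φ) (suc m)                        ≈⟨ trans (coeff-+ₚ (α · compAffine u e φ) (const β) (suc m)) (+-identityʳ _) ⟩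
        coeff (α · compAffine u e φ) (suc m)          ≈⟨ trans (coeff-· α (compAffine u e φ) (suc m)) (*-congˡ (coeff-compAffine-leading u e (suc m) φ (hasDegree⇒degreeBelow φ φ-degree))) ⟩
        α * (u * u ^ m * coeff φ (suc m))             ≈⟨ *-congˡ (*-congˡ αᵐ≈a) ⟨
        α * (u * u ^ m * α ^ m)                       ≈⟨ solve 4 (λ α u U A → α :* (u :* U :* A) := (α :* u) :* (U :* A)) refl α u (u ^ m) (α ^ m) ⟩
        (α * u) * (u ^ m * α ^ m)                     ≈⟨ *-cong (sym (⁻¹-inverse α α≉0)) (^-distrib-* u α m) ⟨
        1# * (u * α) ^ m                              ≈⟨ *-identityˡ _ ⟩
        (u * α) ^ m                                   ≈⟨ ^-congˡ m (trans (*-comm u α) (⁻¹-inverse α α≉0)) ⟩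
        1# ^ m                                        ≈⟨ 1#^n≈1# m ⟩
        1#                                            ∎

    conj-isCFSRDeg : ∀ φ {d} → HasDegree (conj φ) d → IsCFSRDeg φ d → IsCFSRDeg (conj φ) d
    conj-isCFSRDeg φ ψ-degree (1<d , _ , crit , distinct , critical , fixed , onlyCritical) =
      1<d , ψ-degree , (λ i → γ (crit i)) , distinct′ , critical′ , fixed′ , onlyCritical′
      where
      distinct′ : Distinct (λ i → γ (crit i))
      distinct′ i j i≢j γcᵢ≈γcⱼ = distinct i j i≢j (trans (sym (γ⁻¹∘γ _)) (trans (γ⁻¹-cong γcᵢ≈γcⱼ) (γ⁻¹∘γ _)))

      critical′ : ∀ i → eval (deriv (conj φ)) (γ (crit i)) ≈ 0#
      critical′ i = trans (eval-deriv-conj φ _) (trans (eval-cong (deriv φ) (γ⁻¹∘γ _)) (critical i))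

      fixed′ : ∀ i → eval (conj φ) (γ (crit i)) ≈ γ (crit i)
      fixed′ i = trans (eval-conj φ _) (γ-cong (trans (eval-cong φ (γ⁻¹∘γ _)) (fixed i)))

      onlyCritical′ : ∀ z → eval (deriv (conj φ)) z ≈ 0# → ∃ λ i → z ≈ γ (crit i)
      onlyCritical′ z ψ'z≈0 = i , trans (sym (γ∘γ⁻¹ z)) (γ-cong γ⁻¹z≈cᵢ)
        where
        w = onlyCritical (γ⁻¹ z) (trans (sym (eval-deriv-conj φ z)) ψ'z≈0)
        i = proj₁ w
        γ⁻¹z≈cᵢ = proj₂ w

    conj-normalized : Infinite → ∀ φ {d} → ¬ fromℕ d ≈ 0# →
      (∀ x → fromℕ d * (eval φ x - x) ≈ (x - e) * eval (deriv φ) x) →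
      ∀ n → coeff (conj φ) n - coeff X n ≈ (fromℕ d) ⁻¹ * coeff (0# ∷ deriv (conj φ)) n
    conj-normalized infinite φ {d} δ≉0 identity n = begin
      coeff ψ n - coeff X n                       ≈⟨ coeff--ₚ ψ X n ⟨
      coeff (ψ -ₚ X) n                            ≈⟨ eval≗⇒≈ₚ infinite (ψ -ₚ X) (δ ⁻¹ · (0# ∷ deriv ψ)) pointwise n ⟩
      coeff (δ ⁻¹ · (0# ∷ deriv ψ)) n             ≈⟨ coeff-· (δ ⁻¹) (0# ∷ deriv ψ) n ⟩
      δ ⁻¹ * coeff (0# ∷ deriv ψ) n               ∎
      where
      ψ = conj φ
      δ = fromℕ d

      pointwise : ∀ y → eval (ψ -ₚ X) y ≈ eval (δ ⁻¹ · (0# ∷ deriv ψ)) y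
      pointwise y = begin
        eval (ψ -ₚ X) y                                 ≈⟨ eval--ₚ ψ X y ⟩
        eval ψ y - eval X y                             ≈⟨ +-cong (eval-conj φ y) (-‿cong (trans (eval-X y) (sym (γ∘γ⁻¹ y)))) ⟩
        γ (eval φ w) - γ w                              ≈⟨ solve 4 (λ α P w e → (α :* P :+ :- (α :* e)) :- (α :* w :+ :- (α :* e)) := α :* (P :- w)) refl α (eval φ w) w e ⟩
        α * (eval φ w - w)                              ≈⟨ *-congˡ (⁻¹-cancelˡ (eval φ w - w) δ≉0) ⟨
        α * (δ ⁻¹ * (δ * (eval φ w - w)))               ≈⟨ *-congˡ (*-congˡ (identity w)) ⟩
        α * (δ ⁻¹ * ((w - e) * eval (deriv φ) w))       ≈⟨ solve 5 (λ α δ⁻¹ w e D → α :* (δ⁻¹ :* ((w :- e) :* D)) := δ⁻¹ :* (con 0ℤ :+ (α :* w :+ :- (α :* e)) :* D)) refl α (δ ⁻¹) w e (eval (deriv φ) w) ⟩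
        δ ⁻¹ * (0# + γ w * eval (deriv φ) w)            ≈⟨ *-congˡ (+-congˡ (*-cong (γ∘γ⁻¹ y) (sym (eval-deriv-conj φ y)))) ⟩
        δ ⁻¹ * eval (0# ∷ deriv ψ) y                    ≈⟨ eval-· (δ ⁻¹) (0# ∷ deriv ψ) y ⟨
        eval (δ ⁻¹ · (0# ∷ deriv ψ)) y                  ∎
        where w = γ⁻¹ y

    conj-equivalent : ∀ φ → Equivalent φ (conj φ)
    conj-equivalent φ = α , β , 0# , 1# , det≉0 , commutes
      where
      det≉0 : ¬ α * 1# - β * 0# ≈ 0#
      det≉0 det≈0 = α≉0 (trans (solve 2 (λ α β → α := α :* con 1ℤ :- β :* con 0ℤ) refl α β) det≈0)

      denominator≈1 : ∀ z → 0# * z + 1# ≈ 1#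
      denominator≈1 z = trans (+-congʳ (zeroˡ z)) (+-identityˡ 1#)

      divide-by-1 : ∀ x z → x * (0# * z + 1#) ⁻¹ ≈ x
      divide-by-1 x z = begin
        x * (0# * z + 1#) ⁻¹                       ≈⟨ *-identityˡ _ ⟨
        1# * (x * (0# * z + 1#) ⁻¹)                ≈⟨ *-congʳ (denominator≈1 z) ⟨
        (0# * z + 1#) * (x * (0# * z + 1#) ⁻¹)     ≈⟨ solve 3 (λ D x D⁻¹ → D :* (x :* D⁻¹) := x :* (D :* D⁻¹)) refl (0# * z + 1#) x ((0# * z + 1#) ⁻¹) ⟩
        x * ((0# * z + 1#) * (0# * z + 1#) ⁻¹)     ≈⟨ *-congˡ (⁻¹-inverse _ (λ D≈0 → 1#≉0# (trans (sym (denominator≈1 z)) D≈0))) ⟩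
        x * 1#                                     ≈⟨ *-identityʳ x ⟩
        x                                          ∎

      commutes : ∀ x → ¬ 0# * x + 1# ≈ 0# → ¬ 0# * eval φ x + 1# ≈ 0# →
        (α * eval φ x + β) * (0# * eval φ x + 1#) ⁻¹ ≈ eval (conj φ) ((α * x + β) * (0# * x + 1#) ⁻¹)
      commutes x _ _ = begin
        γ (eval φ x) * (0# * eval φ x + 1#) ⁻¹        ≈⟨ divide-by-1 (γ (eval φ x)) (eval φ x) ⟩
        γ (eval φ x)                                  ≈⟨ γ-cong (eval-cong φ (γ⁻¹∘γ x)) ⟨
        γ (eval φ (γ⁻¹ (γ x)))                        ≈⟨ eval-conj φ (γ x) ⟨
        eval (conj φ) (γ x)                           ≈⟨ eval-cong (conj φ) (divide-by-1 (γ x) x) ⟨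
        eval (conj φ) (γ x * (0# * x + 1#) ⁻¹)        ∎

lemma2p8 : {c ℓ : Level} (F : Field c ℓ) → Poly.AlgClosed F →
    (φ : Poly.Pol F) → Poly.IsCFSR F φ →
    ∃ λ (ψ : Poly.Pol F) → Poly.IsNormalizedCFSR F ψ × Poly.Equivalent F φ ψ
lemma2p8 F _         φ (zero , () , _)
lemma2p8 F _         φ (suc zero , s≤s () , _)
lemma2p8 F algClosed φ (d@(suc (suc k)) , φ-cfsr@(_ , φ-degree@(a≉0 , _) , _)) =
  conj φ , (d , conj-isCFSRDeg φ (proj₁ ψ-monic) φ-cfsr , ψ-monic , δ≉0 , conj-normalized infinite φ {d} δ≉0 (proj₂ identity)) ,
  conj-equivalent φ
  where
  open Field F hiding (zero)
  open Poly F
  open PolynomialsOver F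

  infinite : Infinite
  infinite = algClosed⇒infinite algClosed

  δ≉0 : ¬ fromℕ d ≈ 0#
  δ≉0 = cfsr-degree≉0 infinite φ φ-cfsr

  identity = cfsr-fixedPointIdentity φ φ-cfsr δ≉0
  root = algClosed⇒root algClosed k (coeff φ d)
  α = proj₁ root

  α≉0 : ¬ α ≈ 0#
  α≉0 α≈0 = a≉0 (trans (sym (proj₂ root)) (trans (*-congʳ α≈0) (zeroˡ _)))

  open Conjugation α α≉0 (proj₁ identity)
  ψ-monic = conj-monic φ φ-degree (proj₂ root)
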